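{- Let $n\geq 3$ and $\vec{x}\in\mathbb{Z}^n$ with $k(\vec{x})<n$. Then $f$ satisfies the $n$-dimensional tarai recurrence at $\vec{x}$: if $\vec{x}(1)\leq\vec{x}(2)$ then $f(\vec{x})=\vec{x}(2)$, and if $\vec{x}(1)>\vec{x}(2)$ then $f(\vec{x})=f(\vec{y})$, where $\vec{y}\in\mathbb{Z}^n$ is given by $\vec{y}(i)=f(\sigma(r^{i-1}(\vec{x})))$ for $i=1,\ldots,n$.
   Context: For $\vec{x}=\langle x_1,\ldots,x_n\rangle\in\mathbb{Z}^n$ write $\vec{x}(i)=x_i$, $\sigma(\vec{x})=\langle x_1-1,x_2,\ldots,x_n\rangle$ and $r(\vec{x})=\langle x_2,\ldots,x_n,x_1\rangle$. $k(\vec{x})=n$ if $\vec{x}(1)>\cdots>\vec{x}(n)$, otherwise the least $k$ with $\vec{x}(k)\leq\vec{x}(k+1)$. $l(\vec{x})$ is the least $l$ with $1\leq l<k(\vec{x})$, $\vec{x}(l)>\vec{x}(l+1)+1$ and $\vec{x}(l+1)=\vec{x}(l+2)+1$ if it exists, otherwise $k(\vec{x})-1$. The function $f:\mathbb{Z}^n\to\mathbb{Z}$ (Bailey–Cowles) is given by: $f(\vec{x})=\vec{x}(1)$ if $k(\vec{x})=n$, and $f(\vec{x})=\max\{\vec{x}(l(\vec{x})+2),\vec{x}(k(\vec{x})+1)\}$ if $k(\vec{x})<n$. -}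

module Defs where

open import Data.Nat using (ℕ; zero; suc; _∸_) renaming (_<?_ to _<ℕ?_; _≟_ to _≟ℕ_)
open import Data.Fin using (Fin; fromℕ<; toℕ)
import Data.Fin
open import Data.Integer using (ℤ; _≤?_; _<?_; _⊔_; _-_; 1ℤ; +_) renaming (_+_ to _+ℤ_; _≟_ to _≟ℤ_)
open import Data.Bool using (Bool; true; false; if_then_else_; _∧_)
open import Relation.Nullary.Decidable using (⌊_⌋; yes; no)
open import Relation.Binary.PropositionalEquality using (_≡_)
open import Data.Vec.Functional using (Vector)

-- Vectors in ℤ^n are functions Fin n → ℤ; paper index i (1-based) is Fin position i-1.

-- 1-based access: x ! i = x(i) for 1 ≤ i ≤ n (value 0 outside range, never used).
_!_ : ∀ {n} → Vector ℤ n → ℕ → ℤ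
_!_ {n} x zero = + 0
_!_ {n} x (suc j) with j <ℕ? n
... | yes p = x (fromℕ< p)
... | no _  = + 0

σ : ∀ {n} → Vector ℤ n → Vector ℤ n
σ x i with toℕ i
... | zero  = x i - 1ℤ
... | suc _ = x i

-- r(x) = ⟨x₂, …, xₙ, x₁⟩
r : ∀ {n} → Vector ℤ n → Vector ℤ n
r {zero}  x ()
r {suc n} x i with suc (toℕ i) <ℕ? suc n
... | yes p = x (fromℕ< p)
... | no _  = x Data.Fin.zero

r^ : ∀ {n} → ℕ → Vector ℤ n → Vector ℤ n
r^ zero    x = x
r^ (suc m) x = r (r^ m x)

-- k(x): least k with 1 ≤ k < n and x(k) ≤ x(k+1); n if none (strictly decreasing).
-- kFrom x j c : search k = j, j+1, …, with c remaining candidates.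
kFrom : ∀ {n} → Vector ℤ n → ℕ → ℕ → ℕ
kFrom {n} x j zero    = n
kFrom {n} x j (suc c) = if ⌊ (x ! j) ≤? (x ! suc j) ⌋ then j else kFrom x (suc j) c

kk : ∀ {n} → Vector ℤ n → ℕ
kk {zero}  x = zero
kk {suc n} x = kFrom x 1 n

-- l(x): least l with 1 ≤ l < k(x), x(l) > x(l+1)+1 and x(l+1) = x(l+2)+1; else k(x)-1.
lFrom : ∀ {n} → Vector ℤ n → ℕ → ℕ → ℕ → ℕ
lFrom x kv j zero = kv ∸ 1
lFrom x kv j (suc c) =
  if ⌊ ((x ! suc j) +ℤ 1ℤ) <? (x ! j) ⌋ ∧ ⌊ (x ! suc j) ≟ℤ ((x ! suc (suc j)) +ℤ 1ℤ) ⌋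
  then j else lFrom x kv (suc j) c

ll : ∀ {n} → Vector ℤ n → ℕ
ll x = lFrom x (kk x) 1 (kk x ∸ 1)

f : ∀ {n} → Vector ℤ n → ℤ
f {n} x with kk x ≟ℕ n
... | yes _ = x ! 1
... | no _  = (x ! suc (suc (ll x))) ⊔ (x ! suc (kk x))

-- Let K = k(x) and c = x(K+1), so x(1) > ⋯ > x(K) ≤ c, and let F(m) be f(x) computed with the
-- search for l started at position m, so that F(1) = f(x) and F is antitone. For 1 ≤ m ≤ K the
-- vector σ(r^(m-1) x) = ⟨x(m) - 1, x(m+1), …⟩ has its first ascent at 1 or at K - m + 1, so
-- y(m) = f(σ(r^(m-1) x)) is expressed through x alone: it is x(m+1), x(m+2) ⊔ c or F(m+1).
-- From this, F(j) = F(j+1) whenever y(j+1) < y(j), and F(j) = y(j+1) whenever y(j) ≤ y(j+1).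
-- Since y(K-1) ≤ y(K) = c, the first ascent k of y lies below K, hence F(1) = F(k) = y(k+1);
-- and every candidate y(l+2) for l(y) is bounded by F(l+2) ≤ F(1), so f(y) = y(k+1) = f(x).

module Submission where

open import Defs
open import Data.Nat using (ℕ; zero; suc; _∸_; _≥_; z≤n; s≤s) renaming (_<?_ to _<ℕ?_)
import Data.Nat as ℕ
import Data.Nat.Properties as ℕ
open import Data.Fin using (Fin; fromℕ<; toℕ)
open import Data.Fin.Properties using (toℕ-fromℕ<; fromℕ<-cong)
open import Data.Integer using (ℤ; _≤_; _<_; _>_; _+_; _-_; -_; 1ℤ; _⊔_; _≤?_; _<?_) renaming (_≟_ to _≟ℤ_)
open import Data.Integer.Properties
open import Data.Vec.Functional using (Vector)
open import Data.Product using (_×_; _,_; Σ-syntax)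
open import Data.Sum using (_⊎_; inj₁; inj₂)
open import Data.Empty using (⊥; ⊥-elim)
open import Relation.Nullary using (¬_; yes; no; Dec; _×-dec_)
open import Relation.Binary.PropositionalEquality
open import Function using (_∘′_)

i<j⇒i+1≤j : ∀ {i j} → i < j → i + 1ℤ ≤ j
i<j⇒i+1≤j {i} {j} p = subst (_≤ j) (+-comm 1ℤ i) (i<j⇒suc[i]≤j p)

i+1≤j⇒i<j : ∀ {i j} → i + 1ℤ ≤ j → i < j
i+1≤j⇒i<j {i} {j} p = suc[i]≤j⇒i<j (subst (_≤ j) (+-comm i 1ℤ) p)

i≤i+1 : ∀ i → i ≤ i + 1ℤ
i≤i+1 i = <⇒≤ (i+1≤j⇒i<j ≤-refl)

i+1≰i : ∀ {i} → ¬ (i + 1ℤ ≤ i)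
i+1≰i p = <-irrefl refl (i+1≤j⇒i<j p)

j<i≤j+1⇒i≡j+1 : ∀ {i j} → j < i → i ≤ j + 1ℤ → i ≡ j + 1ℤ
j<i≤j+1⇒i≡j+1 p q = ≤-antisym q (i<j⇒i+1≤j p)

i-1+1≡i : ∀ i → i - 1ℤ + 1ℤ ≡ i
i-1+1≡i i = trans (+-assoc i (- 1ℤ) 1ℤ) (trans (cong (i +_) (+-inverseˡ 1ℤ)) (+-identityʳ i))

i+1-1≡i : ∀ i → i + 1ℤ - 1ℤ ≡ i
i+1-1≡i i = trans (+-assoc i 1ℤ (- 1ℤ)) (trans (cong (i +_) (+-inverseʳ 1ℤ)) (+-identityʳ i))

i<j-1⇒i<j : ∀ {i j} → i < j - 1ℤ → i < j
i<j-1⇒i<j {j = j} p = <-trans p (i+1≤j⇒i<j (≤-reflexive (i-1+1≡i j)))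

i≤j+1⇒i-1≤j : ∀ {i j} → i ≤ j + 1ℤ → i - 1ℤ ≤ j
i≤j+1⇒i-1≤j {i} {j} p = subst (i - 1ℤ ≤_) (i+1-1≡i j) (+-monoˡ-≤ (- 1ℤ) p)

i-1≤j⇒i≤j+1 : ∀ {i j} → i - 1ℤ ≤ j → i ≤ j + 1ℤ
i-1≤j⇒i≤j+1 {i} {j} p = subst (_≤ j + 1ℤ) (i-1+1≡i i) (+-monoˡ-≤ 1ℤ p)

i<i⊔j⇒i<j : ∀ i j → i < i ⊔ j → i < j
i<i⊔j⇒i<j i j h with j ≤? i
... | yes j≤i = ⊥-elim (<-irrefl (sym (i≥j⇒i⊔j≡i j≤i)) h)
... | no j≰i = ≰⇒> j≰i

-- Entries of σ and rotations

!-fromℕ< : ∀ {n} (x : Vector ℤ n) (j : ℕ) (p : j ℕ.< n) → x ! suc j ≡ x (fromℕ< p)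
!-fromℕ< {n} x j p with j <ℕ? n
... | yes q = cong x (fromℕ<-cong j j refl q p)
... | no ¬q = ⊥-elim (¬q p)

r-fromℕ< : ∀ {n} (x : Vector ℤ (suc n)) (i : Fin (suc n)) (p : suc (toℕ i) ℕ.< suc n) →
           r x i ≡ x (fromℕ< p)
r-fromℕ< {n} x i p with suc (toℕ i) <ℕ? suc n
... | yes q = cong x (fromℕ<-cong _ _ refl q p)
... | no ¬q = ⊥-elim (¬q p)

r-! : ∀ {n} (x : Vector ℤ n) (j : ℕ) → suc j ℕ.< n → r x ! suc j ≡ x ! suc (suc j)
r-! {suc n} x j p = begin
  r x ! suc j                 ≡⟨ !-fromℕ< (r x) j j<n ⟩
  r x (fromℕ< j<n)            ≡⟨ r-fromℕ< x (fromℕ< j<n) p′ ⟩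
  x (fromℕ< p′)               ≡⟨ cong x (fromℕ<-cong _ _ (cong suc (toℕ-fromℕ< j<n)) p′ p) ⟩
  x (fromℕ< p)                ≡⟨ !-fromℕ< x (suc j) p ⟨
  x ! suc (suc j)             ∎
  where
  open ≡-Reasoning
  j<n : j ℕ.< suc n
  j<n = ℕ.<-trans (ℕ.n<1+n j) p
  p′ : suc (toℕ (fromℕ< j<n)) ℕ.< suc n
  p′ = subst (λ t → suc t ℕ.< suc n) (sym (toℕ-fromℕ< j<n)) p

r^-! : ∀ {n} (x : Vector ℤ n) (m j : ℕ) → m ℕ.+ j ℕ.< n → r^ m x ! suc j ≡ x ! suc (m ℕ.+ j)
r^-! x zero    j p = refl
r^-! {n} x (suc m) j p = begin
  r (r^ m x) ! suc j       ≡⟨ r-! (r^ m x) j (ℕ.≤-<-trans (s≤s (ℕ.m≤n+m j m)) p) ⟩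
  r^ m x ! suc (suc j)     ≡⟨ r^-! x m (suc j) (subst (ℕ._< n) (sym (ℕ.+-suc m j)) p) ⟩
  x ! suc (m ℕ.+ suc j)    ≡⟨ cong (λ t → x ! suc t) (ℕ.+-suc m j) ⟩
  x ! suc (suc m ℕ.+ j)    ∎
  where open ≡-Reasoning

σ-head : ∀ {n} (x : Vector ℤ n) (i : Fin n) → toℕ i ≡ 0 → σ x i ≡ x i - 1ℤ
σ-head x i e with toℕ i
σ-head x i refl | .zero = refl

σ-tail : ∀ {n} (x : Vector ℤ n) (i : Fin n) (k : ℕ) → toℕ i ≡ suc k → σ x i ≡ x i
σ-tail x i k e with toℕ i
σ-tail x i k refl | .(suc k) = refl

σ-!-1 : ∀ {n} (x : Vector ℤ n) → 0 ℕ.< n → σ x ! 1 ≡ x ! 1 - 1ℤ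
σ-!-1 x p = trans (!-fromℕ< (σ x) 0 p)
  (trans (σ-head x (fromℕ< p) (toℕ-fromℕ< p)) (cong (_- 1ℤ) (sym (!-fromℕ< x 0 p))))

σ-!-suc : ∀ {n} (x : Vector ℤ n) (j : ℕ) → suc j ℕ.< n → σ x ! suc (suc j) ≡ x ! suc (suc j)
σ-!-suc x j p = trans (!-fromℕ< (σ x) (suc j) p)
  (trans (σ-tail x (fromℕ< p) j (toℕ-fromℕ< p)) (sym (!-fromℕ< x (suc j) p)))

σr^-!-1 : ∀ {n} (x : Vector ℤ n) (i : ℕ) → i ℕ.< n → σ (r^ i x) ! 1 ≡ x ! suc i - 1ℤ
σr^-!-1 {n} x i p = trans (σ-!-1 (r^ i x) (ℕ.≤-<-trans z≤n p))
  (cong (_- 1ℤ) (trans (r^-! x i 0 (subst (ℕ._< n) (sym (ℕ.+-identityʳ i)) p))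
                       (cong (λ t → x ! suc t) (ℕ.+-identityʳ i))))

σr^-!-suc : ∀ {n} (x : Vector ℤ n) (i t : ℕ) → i ℕ.+ suc t ℕ.< n →
            σ (r^ i x) ! suc (suc t) ≡ x ! suc (suc (i ℕ.+ t))
σr^-!-suc x i t p = trans (σ-!-suc (r^ i x) t (ℕ.≤-<-trans (ℕ.m≤n+m (suc t) i) p))
  (trans (r^-! x i (suc t) p) (cong (λ u → x ! suc u) (ℕ.+-suc i t)))

-- The first ascent k and the search for l

kk≡kFrom : ∀ {n} (x : Vector ℤ n) → kk x ≡ kFrom x 1 (n ∸ 1)
kk≡kFrom {zero}  x = refl
kk≡kFrom {suc n} x = refl

module _ {n : ℕ} (x : Vector ℤ n) where

  Ascent : ℕ → Set
  Ascent m = x ! m ≤ x ! suc m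

  DescendsOn : ℕ → ℕ → Set
  DescendsOn i j = ∀ m → i ℕ.≤ m → m ℕ.< j → ¬ Ascent m

  kFrom-spec : ∀ j c → kFrom x j c ℕ.< n →
    j ℕ.≤ kFrom x j c × DescendsOn j (kFrom x j c) × Ascent (kFrom x j c)
  kFrom-spec j zero p = ⊥-elim (ℕ.<-irrefl refl p)
  kFrom-spec j (suc c) p with x ! j ≤? x ! suc j
  ... | yes a = ℕ.≤-refl , (λ m j≤m m<j → ⊥-elim (ℕ.<-irrefl refl (ℕ.≤-<-trans j≤m m<j))) , a
  ... | no ¬a with kFrom-spec (suc j) c p
  ...   | j<k , desc , asc = ℕ.<⇒≤ j<k , desc′ , asc
    where
    desc′ : DescendsOn j (kFrom x (suc j) c)
    desc′ m j≤m m<k with ℕ.m≤n⇒m<n∨m≡n j≤m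
    ... | inj₁ j<m = desc m j<m m<k
    ... | inj₂ refl = ¬a

  kFrom-≤ : ∀ c j m → j ℕ.≤ m → m ℕ.< j ℕ.+ c → Ascent m → kFrom x j c ℕ.≤ m
  kFrom-≤ zero j m j≤m m<j+0 _ =
    ⊥-elim (ℕ.<-irrefl refl (ℕ.<-≤-trans (subst (m ℕ.<_) (ℕ.+-identityʳ j) m<j+0) j≤m))
  kFrom-≤ (suc c) j m j≤m m<j+c a with x ! j ≤? x ! suc j
  ... | yes _ = j≤m
  ... | no ¬a with ℕ.m≤n⇒m<n∨m≡n j≤m
  ...   | inj₂ refl = ⊥-elim (¬a a)
  ...   | inj₁ j<m = kFrom-≤ c (suc j) m j<m (subst (m ℕ.<_) (ℕ.+-suc j c) m<j+c) a

  kFrom-unique : ∀ c j K → j ℕ.≤ K → K ℕ.< j ℕ.+ c → DescendsOn j K → Ascent K → kFrom x j c ≡ K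
  kFrom-unique zero j K j≤K K<j+0 _ _ =
    ⊥-elim (ℕ.<-irrefl refl (ℕ.<-≤-trans (subst (K ℕ.<_) (ℕ.+-identityʳ j) K<j+0) j≤K))
  kFrom-unique (suc c) j K j≤K K<j+c desc a with x ! j ≤? x ! suc j | ℕ.m≤n⇒m<n∨m≡n j≤K
  ... | yes aj | inj₁ j<K = ⊥-elim (desc j ℕ.≤-refl j<K aj)
  ... | yes _  | inj₂ j≡K = j≡K
  ... | no ¬aj | inj₂ refl = ⊥-elim (¬aj a)
  ... | no _   | inj₁ j<K = kFrom-unique c (suc j) K j<K (subst (K ℕ.<_) (ℕ.+-suc j c) K<j+c)
                             (λ m j<m → desc m (ℕ.<⇒≤ j<m)) a

  record FirstAscent (K : ℕ) : Set where
    field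
      1≤K      : 1 ℕ.≤ K
      K<n      : K ℕ.< n
      descends : DescendsOn 1 K
      ascends  : Ascent K

  private
    <n⇒<1+[n∸1] : ∀ {m} → m ℕ.< n → m ℕ.< 1 ℕ.+ (n ∸ 1)
    <n⇒<1+[n∸1] m<n = ℕ.<-≤-trans m<n (ℕ.m≤n+m∸n n 1)

  kk-firstAscent : kk x ℕ.< n → FirstAscent (kk x)
  kk-firstAscent k<n with kFrom-spec 1 (n ∸ 1) (subst (ℕ._< n) (kk≡kFrom x) k<n)
  ... | 1≤k , desc , asc = record
    { 1≤K      = subst (1 ℕ.≤_) (sym (kk≡kFrom x)) 1≤k
    ; K<n      = k<n
    ; descends = λ m 1≤m m<k → desc m 1≤m (subst (m ℕ.<_) (kk≡kFrom x) m<k)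
    ; ascends  = subst Ascent (sym (kk≡kFrom x)) asc
    }

  firstAscent⇒kk≡ : ∀ {K} → FirstAscent K → kk x ≡ K
  firstAscent⇒kk≡ fa = trans (kk≡kFrom x)
    (kFrom-unique (n ∸ 1) 1 _ 1≤K (<n⇒<1+[n∸1] K<n) descends ascends)
    where open FirstAscent fa

  kk≤ : ∀ {m} → 1 ℕ.≤ m → m ℕ.< n → Ascent m → kk x ℕ.≤ m
  kk≤ 1≤m m<n a = subst (ℕ._≤ _) (sym (kk≡kFrom x)) (kFrom-≤ (n ∸ 1) 1 _ 1≤m (<n⇒<1+[n∸1] m<n) a)

  Pattern : ℕ → Set
  Pattern j = (x ! suc j + 1ℤ < x ! j) × (x ! suc j ≡ x ! suc (suc j) + 1ℤ)

  pattern? : ∀ j → Dec (Pattern j)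
  pattern? j = (x ! suc j + 1ℤ <? x ! j) ×-dec (x ! suc j ≟ℤ x ! suc (suc j) + 1ℤ)

  lFrom-pattern : ∀ kv j c → Pattern j → lFrom x kv j (suc c) ≡ j
  lFrom-pattern kv j c (p , q) with x ! suc j + 1ℤ <? x ! j | x ! suc j ≟ℤ x ! suc (suc j) + 1ℤ
  ... | yes _ | yes _ = refl
  ... | no ¬p | _     = ⊥-elim (¬p p)
  ... | yes _ | no ¬q = ⊥-elim (¬q q)

  lFrom-skip : ∀ kv j c → ¬ Pattern j → lFrom x kv j (suc c) ≡ lFrom x kv (suc j) c
  lFrom-skip kv j c ¬pq with x ! suc j + 1ℤ <? x ! j | x ! suc j ≟ℤ x ! suc (suc j) + 1ℤ
  ... | yes p | yes q = ⊥-elim (¬pq (p , q))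
  ... | no _  | _     = refl
  ... | yes _ | no _  = refl

  lTail : ℕ → ℕ → ℕ → ℤ
  lTail kv j c = x ! suc (suc (lFrom x kv j c))

  lTail-pattern : ∀ kv j c → Pattern j → lTail kv j (suc c) ≡ x ! suc (suc j)
  lTail-pattern kv j c p = cong (λ l → x ! suc (suc l)) (lFrom-pattern kv j c p)

  lTail-skip : ∀ kv j c → ¬ Pattern j → lTail kv j (suc c) ≡ lTail kv (suc j) c
  lTail-skip kv j c ¬p = cong (λ l → x ! suc (suc l)) (lFrom-skip kv j c ¬p)

  lTail-cases : ∀ kv j c → lTail kv j c ≡ x ! suc (suc (kv ∸ 1)) ⊎
    Σ[ l ∈ ℕ ] j ℕ.≤ l × l ℕ.< j ℕ.+ c × Pattern l × lTail kv j c ≡ x ! suc (suc l)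
  lTail-cases kv j zero = inj₁ refl
  lTail-cases kv j (suc c) with pattern? j
  ... | yes p = inj₂ (j , ℕ.≤-refl , ℕ.m<m+n j (s≤s z≤n) , p , lTail-pattern kv j c p)
  ... | no ¬p with lTail-cases kv (suc j) c
  ...   | inj₁ e = inj₁ (trans (lTail-skip kv j c ¬p) e)
  ...   | inj₂ (l , j<l , l<j+c , p , e) =
          inj₂ (l , ℕ.<⇒≤ j<l , subst (l ℕ.<_) (sym (ℕ.+-suc j c)) l<j+c , p ,
                trans (lTail-skip kv j c ¬p) e)

  f-firstAscent : ∀ {K} → FirstAscent K → f x ≡ lTail K 1 (K ∸ 1) ⊔ x ! suc K
  f-firstAscent {K} fa with kk x ℕ.≟ n | firstAscent⇒kk≡ fa
  ... | yes k≡n | refl = ⊥-elim (ℕ.<-irrefl k≡n (FirstAscent.K<n fa))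
  ... | no _    | refl = refl

f-ascent-at-1 : ∀ {n} (x : Vector ℤ n) → 1 ℕ.< n → Ascent x 1 → f x ≡ x ! 2
f-ascent-at-1 x 1<n a = trans (f-firstAscent x first) (⊔-idem (x ! 2))
  where
  first : FirstAscent x 1
  first = record
    { 1≤K      = ℕ.≤-refl
    ; K<n      = 1<n
    ; descends = λ m 1≤m m<1 → ⊥-elim (ℕ.<-irrefl refl (ℕ.≤-<-trans 1≤m m<1))
    ; ascends  = a
    }

Pattern-cong : ∀ {n n′} (x : Vector ℤ n) (x′ : Vector ℤ n′) a b →
  (∀ t → t ℕ.≤ 2 → x ! (t ℕ.+ a) ≡ x′ ! (t ℕ.+ b)) → Pattern x a → Pattern x′ b
Pattern-cong x x′ a b agree (p , q) =
    subst₂ (λ u v → u + 1ℤ < v) (agree 1 (s≤s z≤n)) (agree 0 z≤n) p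
  , subst₂ (λ u v → u ≡ v + 1ℤ) (agree 1 (s≤s z≤n)) (agree 2 ℕ.≤-refl) q

lTail-cong : ∀ {n n′} (x : Vector ℤ n) (x′ : Vector ℤ n′) k k′ c a b →
  (∀ t → t ℕ.≤ suc c → x ! (t ℕ.+ a) ≡ x′ ! (t ℕ.+ b)) →
  x ! suc (suc (k ∸ 1)) ≡ x′ ! suc (suc (k′ ∸ 1)) →
  lTail x k a c ≡ lTail x′ k′ b c
lTail-cong x x′ k k′ zero    a b _ e = e
lTail-cong x x′ k k′ (suc c) a b agree e with pattern? x a
... | yes p = begin
  lTail x k a (suc c)    ≡⟨ lTail-pattern x k a c p ⟩
  x ! suc (suc a)        ≡⟨ agree 2 (s≤s (s≤s z≤n)) ⟩
  x′ ! suc (suc b)       ≡⟨ lTail-pattern x′ k′ b c p′ ⟨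
  lTail x′ k′ b (suc c)  ∎
  where
  open ≡-Reasoning
  p′ : Pattern x′ b
  p′ = Pattern-cong x x′ a b (λ t t≤2 → agree t (ℕ.≤-trans t≤2 (s≤s (s≤s z≤n)))) p
... | no ¬p = begin
  lTail x k a (suc c)        ≡⟨ lTail-skip x k a c ¬p ⟩
  lTail x k (suc a) c        ≡⟨ lTail-cong x x′ k k′ c (suc a) (suc b) agree′ e ⟩
  lTail x′ k′ (suc b) c      ≡⟨ lTail-skip x′ k′ b c ¬p′ ⟨
  lTail x′ k′ b (suc c)      ∎
  where
  open ≡-Reasoning
  ¬p′ : ¬ Pattern x′ b
  ¬p′ = ¬p ∘′ Pattern-cong x′ x b a (λ t t≤2 → sym (agree t (ℕ.≤-trans t≤2 (s≤s (s≤s z≤n)))))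
  agree′ : ∀ t → t ℕ.≤ suc c → x ! (t ℕ.+ suc a) ≡ x′ ! (t ℕ.+ suc b)
  agree′ t t≤c = subst₂ (λ u v → x ! u ≡ x′ ! v) (sym (ℕ.+-suc t a)) (sym (ℕ.+-suc t b))
                        (agree (suc t) (s≤s t≤c))

-- y compared with x below the first ascent of x

module FromFirstAscent {n : ℕ} (x : Vector ℤ n) {K : ℕ} (first : FirstAscent x K) where
  open FirstAscent first

  c : ℤ
  c = x ! suc K

  suc[K∸1]≡K : suc (K ∸ 1) ≡ K
  suc[K∸1]≡K = ℕ.suc-pred K ⦃ ℕ.>-nonZero 1≤K ⦄

  descent : ∀ m → 1 ℕ.≤ m → m ℕ.< K → x ! suc m < x ! m
  descent m 1≤m m<K = ≰⇒> (descends m 1≤m m<K)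

  x⊔c-antitone-step : ∀ m → 1 ℕ.≤ m → m ℕ.≤ K → x ! suc m ⊔ c ≤ x ! m ⊔ c
  x⊔c-antitone-step m 1≤m m≤K with ℕ.m≤n⇒m<n∨m≡n m≤K
  ... | inj₁ m<K  = ⊔-monoˡ-≤ c (<⇒≤ (descent m 1≤m m<K))
  ... | inj₂ refl = ⊔-lub (i≤j⊔i (x ! K) c) (i≤j⊔i (x ! K) c)

  x⊔c-antitone : ∀ {i j} → 1 ℕ.≤ i → i ℕ.≤ j → j ℕ.≤ suc K → x ! j ⊔ c ≤ x ! i ⊔ c
  x⊔c-antitone {i} {j} 1≤i i≤j j≤K+1 with ℕ.m≤n⇒m<n∨m≡n i≤j
  ... | inj₂ refl = ≤-refl
  x⊔c-antitone {i} {suc j} 1≤i _ j≤K+1 | inj₁ (s≤s i≤j′) =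
    ≤-trans (x⊔c-antitone-step j (ℕ.≤-trans 1≤i i≤j′) (ℕ.≤-pred j≤K+1))
            (x⊔c-antitone 1≤i i≤j′ (ℕ.m≤n⇒m≤1+n (ℕ.≤-pred j≤K+1)))

  -- F m is f x with the search for l(x) started at position m instead of 1.
  F : ℕ → ℤ
  F m = lTail x K m (K ∸ m) ⊔ c

  f≡F1 : f x ≡ F 1
  f≡F1 = f-firstAscent x first

  F-K : F K ≡ c
  F-K = begin
    lTail x K K (K ∸ K) ⊔ c    ≡⟨ cong (λ t → lTail x K K t ⊔ c) (ℕ.n∸n≡0 K) ⟩
    x ! suc (suc (K ∸ 1)) ⊔ c  ≡⟨ cong (λ t → x ! suc t ⊔ c) suc[K∸1]≡K ⟩
    c ⊔ c                      ≡⟨ ⊔-idem c ⟩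
    c                          ∎
    where open ≡-Reasoning

  F-pattern : ∀ m → m ℕ.< K → Pattern x m → F m ≡ x ! suc (suc m) ⊔ c
  F-pattern m m<K p = begin
    lTail x K m (K ∸ m) ⊔ c          ≡⟨ cong (λ t → lTail x K m t ⊔ c) (ℕ.+-∸-assoc 1 m<K) ⟩
    lTail x K m (suc (K ∸ suc m)) ⊔ c ≡⟨ cong (_⊔ c) (lTail-pattern x K m (K ∸ suc m) p) ⟩
    x ! suc (suc m) ⊔ c               ∎
    where open ≡-Reasoning

  F-skip : ∀ m → m ℕ.< K → ¬ Pattern x m → F m ≡ F (suc m)
  F-skip m m<K ¬p = begin
    lTail x K m (K ∸ m) ⊔ c           ≡⟨ cong (λ t → lTail x K m t ⊔ c) (ℕ.+-∸-assoc 1 m<K) ⟩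
    lTail x K m (suc (K ∸ suc m)) ⊔ c ≡⟨ cong (_⊔ c) (lTail-skip x K m (K ∸ suc m) ¬p) ⟩
    F (suc m)                          ∎
    where open ≡-Reasoning

  c≤F : ∀ m → c ≤ F m
  c≤F m = i≤j⊔i (lTail x K m (K ∸ m)) c

  F≤x⊔c : ∀ m → m ℕ.≤ K → F m ≤ x ! suc (suc m) ⊔ c
  F≤x⊔c m m≤K with lTail-cases x K m (K ∸ m)
  ... | inj₁ e = ≤-trans (≤-reflexive (trans (cong (_⊔ c) e′) (⊔-idem c))) (i≤j⊔i _ c)
    where
    e′ : lTail x K m (K ∸ m) ≡ c
    e′ = trans e (cong (λ t → x ! suc t) suc[K∸1]≡K)
  ... | inj₂ (l , m≤l , l<K′ , _ , e) = ≤-trans (≤-reflexive (cong (_⊔ c) e))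
          (x⊔c-antitone (s≤s z≤n) (s≤s (s≤s m≤l)) (s≤s l<K))
    where
    l<K : l ℕ.< K
    l<K = subst (l ℕ.<_) (ℕ.m+[n∸m]≡n m≤K) l<K′

  F-antitone : ∀ m → m ℕ.< K → F (suc m) ≤ F m
  F-antitone m m<K with pattern? x m | ℕ.m≤n⇒m<n∨m≡n m<K
  ... | no ¬p | _ = ≤-reflexive (sym (F-skip m m<K ¬p))
  ... | yes _ | inj₂ refl = ≤-trans (≤-reflexive F-K) (c≤F m)
  ... | yes p | inj₁ m+1<K = ≤-trans (F≤x⊔c (suc m) (ℕ.<⇒≤ m+1<K))
      (≤-trans (x⊔c-antitone-step (suc (suc m)) (s≤s z≤n) m+1<K) (≤-reflexive (sym (F-pattern m m<K p))))

  F≤F1 : ∀ m → 1 ℕ.≤ m → m ℕ.≤ K → F m ≤ F 1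
  F≤F1 (suc zero)    _ _   = ≤-refl
  F≤F1 (suc (suc m)) _ m<K = ≤-trans (F-antitone (suc m) m<K) (F≤F1 (suc m) (s≤s z≤n) (ℕ.<⇒≤ m<K))

  F≡c : ∀ m → m ℕ.≤ K → x ! suc m ≤ F m → F m ≡ c
  F≡c m m≤K h with ℕ.m≤n⇒m<n∨m≡n m≤K
  ... | inj₂ refl = F-K
  ... | inj₁ m<K with x ! suc (suc m) ≤? c
  ...   | yes x≤c = ≤-antisym (≤-trans (F≤x⊔c m m≤K) (≤-reflexive (i≤j⇒i⊔j≡j x≤c))) (c≤F m)
  ...   | no x≰c with ℕ.m≤n⇒m<n∨m≡n m<K
  ...     | inj₂ refl = ⊥-elim (x≰c ≤-refl)
  ...     | inj₁ m+1<K = ⊥-elim (<-irrefl refl (<-≤-trans (descent (suc m) (s≤s z≤n) m+1<K)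
              (≤-trans h (≤-trans (F≤x⊔c m m≤K) (≤-reflexive (i≥j⇒i⊔j≡i (<⇒≤ (≰⇒> x≰c))))))))

  y : Vector ℤ n
  y i = f (σ (r^ (toℕ i) x))

  y-! : ∀ i → i ℕ.< n → y ! suc i ≡ f (σ (r^ i x))
  y-! i i<n = trans (!-fromℕ< y i i<n) (cong (λ t → f (σ (r^ t x))) (toℕ-fromℕ< i<n))

  SmallStep : ℕ → Set
  SmallStep m = x ! m ≤ x ! suc m + 1ℤ

  smallStep? : ∀ m → Dec (SmallStep m)
  smallStep? m = x ! m ≤? x ! suc m + 1ℤ

  -- Pattern (σ (r^ (m - 1) x)) 1, read off in terms of x.
  ShiftedPattern : ℕ → Set
  ShiftedPattern m = (x ! suc m + 1ℤ < x ! m - 1ℤ) × (x ! suc m ≡ x ! suc (suc m) + 1ℤ)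

  shiftedPattern? : ∀ m → Dec (ShiftedPattern m)
  shiftedPattern? m = (x ! suc m + 1ℤ <? x ! m - 1ℤ) ×-dec (x ! suc m ≟ℤ x ! suc (suc m) + 1ℤ)

  y-small : ∀ m → 1 ℕ.≤ m → m ℕ.≤ K → SmallStep m → y ! m ≡ x ! suc m
  y-small (suc i) _ i<K small = begin
    y ! suc i          ≡⟨ y-! i (ℕ.<-trans (ℕ.n<1+n i) i+1<n) ⟩
    f z                ≡⟨ f-ascent-at-1 z (ℕ.≤-<-trans (s≤s z≤n) i+1<n) z-ascent ⟩
    z ! 2              ≡⟨ z-2 ⟩
    x ! suc (suc i)    ∎
    where
    open ≡-Reasoning
    z : Vector ℤ n
    z = σ (r^ i x)
    i+1<n : suc i ℕ.< n
    i+1<n = ℕ.≤-<-trans i<K K<n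
    z-2 : z ! 2 ≡ x ! suc (suc i)
    z-2 = trans (σr^-!-suc x i 0 (subst (ℕ._< n) (sym (ℕ.+-comm i 1)) i+1<n))
                (cong (λ t → x ! suc (suc t)) (ℕ.+-identityʳ i))
    z-ascent : Ascent z 1
    z-ascent = subst₂ _≤_ (sym (σr^-!-1 x i (ℕ.<-trans (ℕ.n<1+n i) i+1<n))) (sym z-2) (i≤j+1⇒i-1≤j small)

  -- For m = i + 1 < K with a large step, z = σ (r^ i x) = ⟨x(m) - 1, x(m+1), …⟩ still descends
  -- up to the position of x(K), so its first ascent is at kz = K - i = c′ + 2.
  module LargeStep (i c′ : ℕ) (K≡ : K ≡ suc (suc (i ℕ.+ c′))) (large : ¬ SmallStep (suc i)) where
    z : Vector ℤ n
    z = σ (r^ i x)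

    kz : ℕ
    kz = suc (suc c′)

    i+[2+c′]≡K : i ℕ.+ suc (suc c′) ≡ K
    i+[2+c′]≡K = trans (ℕ.+-suc i (suc c′)) (trans (cong suc (ℕ.+-suc i c′)) (sym K≡))

    z-suc : ∀ t → t ℕ.≤ suc c′ → z ! suc (suc t) ≡ x ! suc (suc (i ℕ.+ t))
    z-suc t t≤ = σr^-!-suc x i t
      (ℕ.≤-<-trans (subst (i ℕ.+ suc t ℕ.≤_) i+[2+c′]≡K (ℕ.+-monoʳ-≤ i (s≤s t≤))) K<n)

    i<n : i ℕ.< n
    i<n = ℕ.<-trans (subst (i ℕ.<_) i+[2+c′]≡K (ℕ.m<m+n i (s≤s z≤n))) K<n

    z-1 : z ! 1 ≡ x ! suc i - 1ℤ
    z-1 = σr^-!-1 x i i<n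

    z-2 : z ! 2 ≡ x ! suc (suc i)
    z-2 = trans (z-suc 0 z≤n) (cong (λ t → x ! suc (suc t)) (ℕ.+-identityʳ i))

    z-3+ : ∀ t → t ℕ.≤ c′ → z ! suc (suc (suc t)) ≡ x ! suc (suc (suc (i ℕ.+ t)))
    z-3+ t t≤ = trans (z-suc (suc t) (s≤s t≤)) (cong (λ u → x ! suc (suc u)) (ℕ.+-suc i t))

    z-3 : z ! 3 ≡ x ! suc (suc (suc i))
    z-3 = trans (z-3+ 0 z≤n) (cong (λ t → x ! suc (suc (suc t))) (ℕ.+-identityʳ i))

    z-end : z ! suc kz ≡ c
    z-end = trans (z-3+ c′ ℕ.≤-refl) (cong (λ k → x ! suc k) (sym K≡))

    z-first : FirstAscent z kz
    z-first = record
      { 1≤K      = s≤s z≤n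
      ; K<n      = ℕ.≤-<-trans (subst (kz ℕ.≤_) i+[2+c′]≡K (ℕ.m≤n+m kz i)) K<n
      ; descends = z-descends
      ; ascends  = subst₂ _≤_ (sym (trans (z-suc c′ (ℕ.n≤1+n c′)) (cong (x !_) (sym K≡)))) (sym z-end) ascends
      }
      where
      z-descends : DescendsOn z 1 kz
      z-descends (suc zero) _ _ asc = large (i-1≤j⇒i≤j+1 (subst₂ _≤_ z-1 z-2 asc))
      z-descends (suc (suc t)) _ (s≤s (s≤s t<c′)) asc =
        descends (suc (suc (i ℕ.+ t))) (s≤s z≤n)
          (subst (suc (suc (i ℕ.+ t)) ℕ.<_) (sym K≡) (s≤s (s≤s (ℕ.+-monoʳ-< i t<c′))))
          (subst₂ _≤_ (z-suc t (ℕ.m≤n⇒m≤1+n (ℕ.<⇒≤ t<c′))) (z-3+ t (ℕ.<⇒≤ t<c′)) asc)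

    y≡lTail⊔c : y ! suc i ≡ lTail z kz 1 (suc c′) ⊔ c
    y≡lTail⊔c = begin
      y ! suc i                              ≡⟨ y-! i i<n ⟩
      f z                                    ≡⟨ f-firstAscent z z-first ⟩
      lTail z kz 1 (suc c′) ⊔ z ! suc kz     ≡⟨ cong (lTail z kz 1 (suc c′) ⊔_) z-end ⟩
      lTail z kz 1 (suc c′) ⊔ c              ∎
      where open ≡-Reasoning

    y-shifted : ShiftedPattern (suc i) → y ! suc i ≡ x ! suc (suc (suc i)) ⊔ c
    y-shifted (p , q) = trans y≡lTail⊔c (cong (_⊔ c) (trans (lTail-pattern z kz 1 c′ z-pattern) z-3))
      where
      z-pattern : Pattern z 1
      z-pattern = subst₂ (λ u v → u + 1ℤ < v) (sym z-2) (sym z-1) p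
                , subst₂ (λ u v → u ≡ v + 1ℤ) (sym z-2) (sym z-3) q

    y-unshifted : ¬ ShiftedPattern (suc i) → y ! suc i ≡ F (suc (suc i))
    y-unshifted ¬sp = trans y≡lTail⊔c (cong (_⊔ c) (begin
      lTail z kz 1 (suc c′)                     ≡⟨ lTail-skip z kz 1 c′ ¬z-pattern ⟩
      lTail z kz 2 c′                           ≡⟨ lTail-cong z x kz K c′ 2 (suc (suc i)) agree z-end′ ⟩
      lTail x K (suc (suc i)) c′                ≡⟨ cong (lTail x K (suc (suc i))) K∸[2+i]≡c′ ⟨
      lTail x K (suc (suc i)) (K ∸ suc (suc i)) ∎))
      where
      open ≡-Reasoning
      ¬z-pattern : ¬ Pattern z 1
      ¬z-pattern (p , q) =
        ¬sp (subst₂ (λ u v → u + 1ℤ < v) z-2 z-1 p , subst₂ (λ u v → u ≡ v + 1ℤ) z-2 z-3 q)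
      agree : ∀ t → t ℕ.≤ suc c′ → z ! (t ℕ.+ 2) ≡ x ! (t ℕ.+ suc (suc i))
      agree t t≤ = trans (cong (z !_) (ℕ.+-comm t 2))
                   (trans (z-suc t t≤) (cong (x !_) (sym (ℕ.+-comm t (suc (suc i))))))
      z-end′ : z ! suc kz ≡ x ! suc (suc (K ∸ 1))
      z-end′ = trans z-end (cong (λ t → x ! suc t) (sym suc[K∸1]≡K))
      K∸[2+i]≡c′ : K ∸ suc (suc i) ≡ c′
      K∸[2+i]≡c′ = trans (cong (_∸ suc (suc i)) K≡) (ℕ.m+n∸m≡n i c′)

  y-shifted : ∀ m → 1 ℕ.≤ m → m ℕ.< K → ¬ SmallStep m → ShiftedPattern m → y ! m ≡ x ! suc (suc m) ⊔ c
  y-shifted (suc i) _ m<K = LargeStep.y-shifted i (K ∸ suc (suc i)) (sym (ℕ.m+[n∸m]≡n m<K))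

  y-unshifted : ∀ m → 1 ℕ.≤ m → m ℕ.< K → ¬ SmallStep m → ¬ ShiftedPattern m → y ! m ≡ F (suc m)
  y-unshifted (suc i) _ m<K = LargeStep.y-unshifted i (K ∸ suc (suc i)) (sym (ℕ.m+[n∸m]≡n m<K))

  smallStep-K : SmallStep K
  smallStep-K = ≤-trans ascends (i≤i+1 c)

  smallStep⇒≡+1 : ∀ m → 1 ℕ.≤ m → m ℕ.< K → SmallStep m → x ! m ≡ x ! suc m + 1ℤ
  smallStep⇒≡+1 m 1≤m m<K = j<i≤j+1⇒i≡j+1 (descent m 1≤m m<K)

  smallStep⇒¬pattern : ∀ m → SmallStep m → ¬ Pattern x m
  smallStep⇒¬pattern m small (p , _) = <-irrefl refl (<-≤-trans p small)

  pattern⇒smallStep : ∀ m → Pattern x m → SmallStep (suc m)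
  pattern⇒smallStep m (_ , q) = ≤-reflexive q

  pattern⇒suc<K : ∀ m → m ℕ.< K → Pattern x m → suc m ℕ.< K
  pattern⇒suc<K m m<K (_ , q) with ℕ.m≤n⇒m<n∨m≡n m<K
  ... | inj₁ m+1<K = m+1<K
  ... | inj₂ refl  = ⊥-elim (i+1≰i (subst (_≤ c) q ascends))

  shiftedPattern⇒pattern : ∀ m → ShiftedPattern m → Pattern x m
  shiftedPattern⇒pattern m (p , q) = i<j-1⇒i<j p , q

  y≤F : ∀ m → 1 ℕ.≤ m → m ℕ.≤ K → ¬ SmallStep m → y ! m ≤ F m
  y≤F m 1≤m m≤K large with ℕ.m≤n⇒m<n∨m≡n m≤K
  ... | inj₂ refl = ⊥-elim (large smallStep-K)
  ... | inj₁ m<K with shiftedPattern? m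
  ...   | yes sp = ≤-reflexive (trans (y-shifted m 1≤m m<K large sp)
                                      (sym (F-pattern m m<K (shiftedPattern⇒pattern m sp))))
  ...   | no ¬sp = ≤-trans (≤-reflexive (y-unshifted m 1≤m m<K large ¬sp)) (F-antitone m m<K)

  y≤x⊔c : ∀ m → 1 ℕ.≤ m → m ℕ.< K → ¬ SmallStep m → y ! m ≤ x ! suc (suc m) ⊔ c
  y≤x⊔c m 1≤m m<K large with shiftedPattern? m
  ... | yes sp = ≤-reflexive (y-shifted m 1≤m m<K large sp)
  ... | no ¬sp = ≤-trans (y≤F m 1≤m (ℕ.<⇒≤ m<K) large) (F≤x⊔c m (ℕ.<⇒≤ m<K))

  y-after-pattern : ∀ j → j ℕ.< K → Pattern x j → y ! suc j ≡ x ! suc (suc j)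
  y-after-pattern j j<K p = y-small (suc j) (s≤s z≤n) (ℕ.<⇒≤ (pattern⇒suc<K j j<K p)) (pattern⇒smallStep j p)

  c≤y : ∀ m → 1 ℕ.≤ m → m ℕ.< K → ¬ SmallStep m → c ≤ y ! m
  c≤y m 1≤m m<K large with shiftedPattern? m
  ... | yes sp = ≤-trans (i≤j⊔i _ c) (≤-reflexive (sym (y-shifted m 1≤m m<K large sp)))
  ... | no ¬sp = ≤-trans (c≤F (suc m)) (≤-reflexive (sym (y-unshifted m 1≤m m<K large ¬sp)))

  y≤x : ∀ m → 1 ℕ.≤ m → m ℕ.< K → c ≤ x ! suc m → y ! m ≤ x ! suc m
  y≤x m 1≤m m<K c≤x with smallStep? m
  ... | yes small = ≤-reflexive (y-small m 1≤m (ℕ.<⇒≤ m<K) small)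
  ... | no large  = ≤-trans (y≤x⊔c m 1≤m m<K large)
      (≤-trans (x⊔c-antitone-step (suc m) (s≤s z≤n) m<K) (≤-reflexive (i≥j⇒i⊔j≡i c≤x)))

  F-descent : ∀ j → 1 ℕ.≤ j → j ℕ.< K → y ! suc j < y ! j → F j ≡ F (suc j)
  F-descent j 1≤j j<K h with pattern? x j
  ... | no ¬p = F-skip j j<K ¬p
  ... | yes p = begin
    F j                  ≡⟨ F-pattern j j<K p ⟩
    x ! suc (suc j) ⊔ c  ≡⟨ i≤j⇒i⊔j≡j (<⇒≤ x<c) ⟩
    c                    ≡⟨ F≡c (suc j) j<K x≤F ⟨
    F (suc j)            ∎
    where
    open ≡-Reasoning
    large : ¬ SmallStep j
    large small = smallStep⇒¬pattern j small p
    x<c : x ! suc (suc j) < c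
    x<c = i<i⊔j⇒i<j _ c (<-≤-trans (subst (_< y ! j) (y-after-pattern j j<K p) h) (y≤x⊔c j 1≤j j<K large))
    x≤F : x ! suc (suc j) ≤ F (suc j)
    x≤F = ≤-trans (<⇒≤ x<c) (c≤F (suc j))

  F-next≡y : ∀ j → 1 ℕ.≤ j → j ℕ.< K → ¬ Pattern x j → y ! j ≤ y ! suc j → F (suc j) ≡ y ! suc j
  F-next≡y j 1≤j j<K ¬p h with ℕ.m≤n⇒m<n∨m≡n j<K
  ... | inj₂ refl = trans F-K (sym (y-small K 1≤K ℕ.≤-refl smallStep-K))
  ... | inj₁ j+1<K with smallStep? (suc j)
  ...   | yes small′ = ⊥-elim (impossible (smallStep? j))
    -- a small step at j + 1 gives y j > y (j + 1) after a small step at j, and Pattern x j after a large one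
    where
    x≡ : x ! suc j ≡ x ! suc (suc j) + 1ℤ
    x≡ = smallStep⇒≡+1 (suc j) (s≤s z≤n) j+1<K small′
    impossible : Dec (SmallStep j) → ⊥
    impossible (yes small) = <-irrefl refl (<-≤-trans (descent (suc j) (s≤s z≤n) j+1<K)
      (subst₂ _≤_ (y-small j 1≤j (ℕ.<⇒≤ j<K) small) (y-small (suc j) (s≤s z≤n) (ℕ.<⇒≤ j+1<K) small′) h))
    impossible (no large) = ¬p (≰⇒> large , x≡)
  ...   | no large′ = ≤-antisym F≤y (y≤F (suc j) (s≤s z≤n) (ℕ.<⇒≤ j+1<K) large′)
    where
    F≤y : F (suc j) ≤ y ! suc j
    F≤y with smallStep? j
    ... | yes small = ≤-trans (F≤x⊔c (suc j) (ℕ.<⇒≤ j+1<K))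
        (≤-trans (x⊔c-antitone (s≤s z≤n) (ℕ.m≤n+m (suc j) 2) (s≤s j+1<K))
          (⊔-lub (≤-trans (≤-reflexive (sym (y-small j 1≤j (ℕ.<⇒≤ j<K) small))) h)
                 (c≤y (suc j) (s≤s z≤n) j+1<K large′)))
    ... | no large =
      ≤-trans (≤-reflexive (sym (y-unshifted j 1≤j j<K large (¬p ∘′ shiftedPattern⇒pattern j)))) h

  F-ascent : ∀ j → 1 ℕ.≤ j → j ℕ.< K → y ! j ≤ y ! suc j → F j ≡ y ! suc j
  F-ascent j 1≤j j<K h with pattern? x j
  ... | no ¬p = trans (F-skip j j<K ¬p) (F-next≡y j 1≤j j<K ¬p h)
  ... | yes p = begin
    F j                  ≡⟨ F-pattern j j<K p ⟩
    x ! suc (suc j) ⊔ c  ≡⟨ i≥j⇒i⊔j≡i c≤x ⟩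
    x ! suc (suc j)      ≡⟨ y-after-pattern j j<K p ⟨
    y ! suc j            ∎
    where
    open ≡-Reasoning
    c≤x : c ≤ x ! suc (suc j)
    c≤x = ≤-trans (c≤y j 1≤j j<K (λ small → smallStep⇒¬pattern j small p))
                  (≤-trans h (≤-reflexive (y-after-pattern j j<K p)))

  y-pattern⇒y≤F : ∀ j → 1 ℕ.≤ j → suc (suc j) ℕ.≤ K → Pattern y j → y ! suc (suc j) ≤ F (suc (suc j))
  y-pattern⇒y≤F j 1≤j j+2≤K (p , q) with smallStep? (suc (suc j))
  ... | no large = y≤F (suc (suc j)) (s≤s z≤n) j+2≤K large
  ... | yes small with x ! suc (suc (suc j)) ≤? c
  ...   | yes x≤c =
    ≤-trans (≤-reflexive (y-small _ (s≤s z≤n) j+2≤K small)) (≤-trans x≤c (c≤F (suc (suc j))))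
  ...   | no x≰c with ℕ.m≤n⇒m<n∨m≡n j+2≤K
  ...     | inj₂ refl = ⊥-elim (x≰c ≤-refl)
  ...     | inj₁ j+2<K = ⊥-elim (impossible (smallStep? (suc j)))
    -- c < x (j + 3) forces y (j + 1) = x (j + 2) and y j ≤ x (j + 1), against y (j + 1) + 1 < y j
    where
    j+1<K : suc j ℕ.< K
    j+1<K = ℕ.<-trans (ℕ.n<1+n (suc j)) j+2<K
    x₃<x₂ : x ! suc (suc (suc j)) < x ! suc (suc j)
    x₃<x₂ = descent (suc (suc j)) (s≤s z≤n) j+2<K
    c≤x₂ : c ≤ x ! suc (suc j)
    c≤x₂ = <⇒≤ (<-trans (≰⇒> x≰c) x₃<x₂)
    y₁≡x₂ : y ! suc j ≡ x ! suc (suc j)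
    y₁≡x₂ = begin
      y ! suc j                     ≡⟨ q ⟩
      y ! suc (suc j) + 1ℤ          ≡⟨ cong (_+ 1ℤ) (y-small _ (s≤s z≤n) j+2≤K small) ⟩
      x ! suc (suc (suc j)) + 1ℤ    ≡⟨ smallStep⇒≡+1 (suc (suc j)) (s≤s z≤n) j+2<K small ⟨
      x ! suc (suc j)               ∎
      where open ≡-Reasoning
    impossible : Dec (SmallStep (suc j)) → ⊥
    impossible (yes small′) = <-irrefl refl (<-≤-trans x₁<y₀ y₀≤x₁)
      where
      x₁<y₀ : x ! suc j < y ! j
      x₁<y₀ = subst (_< y ! j)
        (trans (cong (_+ 1ℤ) y₁≡x₂) (sym (smallStep⇒≡+1 (suc j) (s≤s z≤n) j+1<K small′))) p
      y₀≤x₁ : y ! j ≤ x ! suc j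
      y₀≤x₁ = y≤x j 1≤j (ℕ.<-trans (ℕ.n<1+n j) j+1<K)
        (≤-trans c≤x₂ (<⇒≤ (descent (suc j) (s≤s z≤n) j+1<K)))
    impossible (no large′) = <-irrefl y₁≡x₂ (≤-<-trans
      (≤-trans (y≤x⊔c (suc j) (s≤s z≤n) j+1<K large′) (≤-reflexive (i≥j⇒i⊔j≡i (<⇒≤ (≰⇒> x≰c)))))
      x₃<x₂)

  F1≡F : ∀ {k} → k ℕ.< K → DescendsOn y 1 k → ∀ m → 1 ℕ.≤ m → m ℕ.≤ k → F 1 ≡ F m
  F1≡F k<K desc (suc zero)    _ _      = refl
  F1≡F k<K desc (suc (suc m)) _ m+2≤k = trans (F1≡F k<K desc (suc m) (s≤s z≤n) (ℕ.<⇒≤ m+2≤k))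
    (F-descent (suc m) (s≤s z≤n) (ℕ.<-trans m+2≤k k<K) (≰⇒> (desc (suc m) (s≤s z≤n) m+2≤k)))

  y-ascent-below-K : ∀ m → 1 ℕ.≤ m → suc m ≡ K → Ascent y m
  y-ascent-below-K m 1≤m refl = ≤-trans y≤c (≤-reflexive (sym (y-small K 1≤K ℕ.≤-refl smallStep-K)))
    where
    y≤c : y ! m ≤ c
    y≤c with smallStep? m
    ... | yes small = ≤-trans (≤-reflexive (y-small m 1≤m (ℕ.n≤1+n m) small)) ascends
    ... | no large  = ≤-trans (y≤F m 1≤m (ℕ.n≤1+n m) large)
        (≤-reflexive (trans (F-skip m ℕ.≤-refl (λ p → ℕ.<-irrefl refl (pattern⇒suc<K m ℕ.≤-refl p))) F-K))

  kk-y<K : x ! 2 < x ! 1 → kk y ℕ.< K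
  kk-y<K x₂<x₁ = subst (kk y ℕ.<_) suc[K∸1]≡K
    (s≤s (kk≤ y 1≤K∸1 K∸1<n (y-ascent-below-K (K ∸ 1) 1≤K∸1 suc[K∸1]≡K)))
    where
    1≤K∸1 : 1 ℕ.≤ K ∸ 1
    1≤K∸1 with ℕ.m≤n⇒m<n∨m≡n 1≤K
    ... | inj₁ 1<K  = ℕ.≤-pred (subst (2 ℕ.≤_) (sym suc[K∸1]≡K) 1<K)
    ... | inj₂ refl = ⊥-elim (<-irrefl refl (<-≤-trans x₂<x₁ ascends))
    K∸1<n : K ∸ 1 ℕ.< n
    K∸1<n = ℕ.<-trans (subst (K ∸ 1 ℕ.<_) suc[K∸1]≡K ℕ.≤-refl) K<n

  f-y≡F1 : x ! 2 < x ! 1 → f y ≡ F 1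
  f-y≡F1 x₂<x₁ = trans (f-firstAscent y y-first) (trans (i≤j⇒i⊔j≡j lTail≤y) (sym F1≡y))
    where
    k : ℕ
    k = kk y
    k<K : k ℕ.< K
    k<K = kk-y<K x₂<x₁
    y-first : FirstAscent y k
    y-first = kk-firstAscent y (ℕ.<-trans k<K K<n)
    1≤k : 1 ℕ.≤ k
    1≤k = FirstAscent.1≤K y-first
    suc[k∸1]≡k : suc (k ∸ 1) ≡ k
    suc[k∸1]≡k = ℕ.suc-pred k ⦃ ℕ.>-nonZero 1≤k ⦄
    F1≡y : F 1 ≡ y ! suc k
    F1≡y = trans (F1≡F k<K (FirstAscent.descends y-first) k 1≤k ℕ.≤-refl)
                 (F-ascent k 1≤k k<K (FirstAscent.ascends y-first))
    lTail≤y : lTail y k 1 (k ∸ 1) ≤ y ! suc k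
    lTail≤y with lTail-cases y k 1 (k ∸ 1)
    ... | inj₁ e = ≤-reflexive (trans e (cong (λ t → y ! suc t) suc[k∸1]≡k))
    ... | inj₂ (l , 1≤l , l<k′ , p , e) = begin
      lTail y k 1 (k ∸ 1)   ≡⟨ e ⟩
      y ! suc (suc l)       ≤⟨ y-pattern⇒y≤F l 1≤l l+2≤K p ⟩
      F (suc (suc l))       ≤⟨ F≤F1 (suc (suc l)) (s≤s z≤n) l+2≤K ⟩
      F 1                   ≡⟨ F1≡y ⟩
      y ! suc k             ∎
      where
      open ≤-Reasoning
      l+2≤K : suc (suc l) ℕ.≤ K
      l+2≤K = ℕ.≤-trans (s≤s (subst (l ℕ.<_) suc[k∸1]≡k l<k′)) k<K

lemma3p10 : (n : ℕ) → n ≥ 3 → (x : Vector ℤ n) → kk x Data.Nat.< n →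
    ((x ! 1) ≤ (x ! 2) → f x ≡ x ! 2) ×
    ((x ! 1) > (x ! 2) → f x ≡ f {n} (λ i → f (σ (r^ (toℕ i) x))))
lemma3p10 n n≥3 x k<n = f-ascent-at-1 x 1<n , λ x₂<x₁ → trans f≡F1 (sym (f-y≡F1 x₂<x₁))
  where
  open FromFirstAscent x (kk-firstAscent x k<n)
  1<n : 1 ℕ.< n
  1<n = ℕ.<-≤-trans (s≤s (s≤s z≤n)) n≥3
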